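{- Let $G=(V,E)$ be a graph with $n\ge 1$ vertices. Then $$\mathrm{ID}(G,x)=(-1)^n\sum_{U\in\mathcal{E}_i(G)}(-1)^{|U|}\left((1-x)^{|\{v\in V\setminus U:\ N_G(v)\subseteq U\}|}-1\right).$$
   Context: All graphs are finite, simple and undirected. $N_G(v)$ is the open neighborhood of $v$. The family of $i$-essential sets is $\mathcal{E}_i(G)=\{X\subseteq V:\ \exists v\in V\setminus X \text{ with } N_G(v)\subseteq X\}$. A set $W\subseteq V$ is an independent dominating set of $G$ if every vertex of $V\setminus W$ is adjacent to at least one vertex of $W$ and no two vertices of $W$ are adjacent. The independent domination polynomial is $\mathrm{ID}(G,x)=\sum_{W}x^{|W|}$, the sum over all independent dominating sets $W$ of $G$. -}

module Defs where

open import Data.Bool using (Bool; true; false; not; _∧_; _∨_; if_then_else_)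
open import Data.Nat using (ℕ; zero; suc; _≤_)
open import Data.Fin using (Fin)
open import Data.Fin.Subset using (Subset; ∣_∣)
open import Data.Vec using (Vec; []; _∷_; lookup)
open import Data.List using (List; []; _∷_; map; _++_; filter; foldr; length)
open import Data.Bool.ListAction using (all; any)
open import Data.List using (allFin)
open import Data.Integer using (ℤ; +_; _+_; _*_; -_; _-_; _^_)
open import Relation.Binary.PropositionalEquality using (_≡_)
open import Relation.Nullary.Decidable using (does)
open import Data.Bool using (T?)

record Graph (n : ℕ) : Set where
  field
    adj     : Fin n → Fin n → Bool
    adj-sym : ∀ u v → adj u v ≡ adj v u
    irrefl  : ∀ v → adj v v ≡ false
open Graph public

mem : ∀ {n} → Fin n → Subset n → Bool
mem v U = lookup U v

allSubsets : (n : ℕ) → List (Subset n)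
allSubsets zero    = [] ∷ []
allSubsets (suc n) = map (false ∷_) (allSubsets n) ++ map (true ∷_) (allSubsets n)

sumℤ : List ℤ → ℤ
sumℤ = foldr _+_ (+ 0)

nbhdIn : ∀ {n} → Graph n → Fin n → Subset n → Bool
nbhdIn G v U = all (λ w → not (adj G v w) ∨ mem w U) (allFin _)

isoCount : ∀ {n} → Graph n → Subset n → ℕ
isoCount G U = length (filter (λ v → T? (not (mem v U) ∧ nbhdIn G v U)) (allFin _))

-- U ∈ 𝓔_i(G) : there is v ∈ V \ U with N_G(v) ⊆ U
isEssential : ∀ {n} → Graph n → Subset n → Bool
isEssential G U = any (λ v → not (mem v U) ∧ nbhdIn G v U) (allFin _)

isIndependent : ∀ {n} → Graph n → Subset n → Bool
isIndependent G W =
  all (λ v → all (λ w → not (mem v W ∧ mem w W ∧ adj G v w)) (allFin _)) (allFin _)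

isDominating : ∀ {n} → Graph n → Subset n → Bool
isDominating G W =
  all (λ v → mem v W ∨ any (λ w → mem w W ∧ adj G v w) (allFin _)) (allFin _)

isIndepDom : ∀ {n} → Graph n → Subset n → Bool
isIndepDom G W = isIndependent G W ∧ isDominating G W

-- Evaluation at x of ID(G,x) = Σ_{W independent dominating} x^{|W|}
ID : ∀ {n} → Graph n → ℤ → ℤ
ID {n} G x =
  sumℤ (map (λ W → x ^ ∣ W ∣) (filter (λ W → T? (isIndepDom G W)) (allSubsets n)))

essentialSum : ∀ {n} → Graph n → ℤ → ℤ
essentialSum {n} G x =
  (- + 1) ^ n *
  sumℤ (map (λ U → (- + 1) ^ ∣ U ∣ * ((+ 1 - x) ^ isoCount G U - + 1))
            (filter (λ U → T? (isEssential G U)) (allSubsets n)))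

module Submission where

-- Write y = -x and let C(U) = {v ∉ U : N(v) ⊆ U} (the vertices
-- "trapped" outside U).  By the binomial theorem over subsets,
--   (1 - x)^|C(U)| - 1 = Σ_{S ⊆ C(U)} y^|S| - 1,
-- and the term of a non-essential U vanishes since then C(U) = ∅, so the
-- essential sum runs over all U.  The "- 1" parts cancel because the
-- alternating sum Σ_U (-1)^|U| is 0 for n ≥ 1.  Exchanging the two sums,
-- S ⊆ C(U) holds iff N(S) ⊆ U ⊆ V∖S, and the alternating sum of (-1)^|U| over
-- such an interval is (-1)^|N(S)| if N(S) = V∖S and 0 otherwise.  Finally
-- N(S) = V∖S says exactly that S is independent (N(S) ⊆ V∖S) and dominating
-- (V∖S ⊆ N(S)), and the signs (-1)^n y^|S| (-1)^(n-|S|) collapse to x^|S|.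

open import Defs
open import Data.Bool using (Bool; true; false; not; _∧_; _∨_; T; T?)
open import Data.Bool.Properties using (T-∧; T-≡; ∧-zeroʳ)
open import Data.Bool.ListAction using (all; any)
open import Data.Empty using (⊥-elim)
open import Data.Fin using (Fin; zero; suc)
open import Data.Fin.Subset using (Subset; ∣_∣; ∁)
open import Data.Fin.Subset.Properties using (∣p∣≤n; ∣∁p∣≡n∸∣p∣)
open import Data.Integer using (ℤ; _+_; _*_; -_; _-_; _^_; 0ℤ; 1ℤ; -1ℤ)
open import Data.Integer.Properties using (+-identityˡ; +-identityʳ; +-assoc; *-zeroʳ; *-comm; *-distribˡ-+)
open import Data.Integer.Tactic.RingSolver using (solve-∀)
open import Data.List using (List; []; _∷_; map; _++_; filter; length; tabulate; allFin)
import Data.List.Relation.Unary.All.Properties as All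
import Data.List.Relation.Unary.Any.Properties as Any
open import Data.Nat using (ℕ; zero; suc; _≤_) renaming (_+_ to _+ℕ_)
open import Data.Nat.Properties using (m∸n+n≡m)
open import Data.Product using (∃; _×_; _,_; proj₁; proj₂)
open import Data.Unit using (tt)
open import Data.Vec using ([]; _∷_)
import Data.Vec as Vec
open import Data.Vec.Properties using (lookup∘tabulate; lookup-map)
open import Function using (_∘_; _$_; _⇔_; mk⇔; Equivalence)
open import Relation.Nullary using (¬_)
open import Relation.Binary.PropositionalEquality
  using (_≡_; refl; sym; trans; cong; cong₂; subst; module ≡-Reasoning)

open Equivalence using (to; from)
open ≡-Reasoning

private
  variable
    A B : Set

T-ext : ∀ {a b} → (T a → T b) → (T b → T a) → a ≡ b
T-ext {true}  {true}  _ _ = refl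
T-ext {true}  {false} f _ = ⊥-elim (f tt)
T-ext {false} {true}  _ g = ⊥-elim (g tt)
T-ext {false} {false} _ _ = refl

T-not : ∀ {a} → T (not a) ⇔ (¬ T a)
T-not {true}  = mk⇔ (λ ()) (λ f → f tt)
T-not {false} = mk⇔ (λ _ ()) (λ _ → tt)

T-implies : ∀ {a b} → T (not a ∨ b) ⇔ (T a → T b)
T-implies {true}  = mk⇔ (λ t _ → t) (λ f → f tt)
T-implies {false} = mk⇔ (λ _ ()) (λ _ → tt)

T-all : ∀ {n} {p : Fin n → Bool} → T (all p (allFin n)) ⇔ (∀ i → T (p i))
T-all {p = p} = mk⇔ (All.tabulate⁻ ∘ All.all⁺ p _) (All.all⁻ p ∘ All.tabulate⁺)

T-any : ∀ {n} {p : Fin n → Bool} → T (any p (allFin n)) ⇔ ∃ (λ i → T (p i))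
T-any {p = p} = mk⇔ (Any.tabulate⁻ ∘ Any.any⁻ p _)
                    (λ (i , pᵢ) → Any.any⁺ p (Any.tabulate⁺ i pᵢ))

∑ : List A → (A → ℤ) → ℤ
∑ l f = sumℤ (map f l)

onlyIf : Bool → ℤ → ℤ
onlyIf true  z = z
onlyIf false _ = 0ℤ

onlyIf-*ˡ : ∀ b k z → onlyIf b (k * z) ≡ k * onlyIf b z
onlyIf-*ˡ true  k z = refl
onlyIf-*ˡ false k z = sym (*-zeroʳ k)

∑-++ : ∀ (l₁ l₂ : List A) (f : A → ℤ) → ∑ (l₁ ++ l₂) f ≡ ∑ l₁ f + ∑ l₂ f
∑-++ []       l₂ f = sym (+-identityˡ _)
∑-++ (a ∷ l₁) l₂ f = trans (cong (_+_ (f a)) (∑-++ l₁ l₂ f)) (sym (+-assoc (f a) _ _))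

∑-map : ∀ (g : A → B) (l : List A) (f : B → ℤ) → ∑ (map g l) f ≡ ∑ l (f ∘ g)
∑-map g []      f = refl
∑-map g (a ∷ l) f = cong (_+_ (f (g a))) (∑-map g l f)

∑-cong : ∀ (l : List A) {f g : A → ℤ} → (∀ a → f a ≡ g a) → ∑ l f ≡ ∑ l g
∑-cong []      f≡g = refl
∑-cong (a ∷ l) f≡g = cong₂ _+_ (f≡g a) (∑-cong l f≡g)

∑-zero : ∀ (l : List A) → ∑ l (λ _ → 0ℤ) ≡ 0ℤ
∑-zero []      = refl
∑-zero (a ∷ l) = trans (+-identityˡ _) (∑-zero l)

∑-+ : ∀ (l : List A) (f g : A → ℤ) → ∑ l (λ a → f a + g a) ≡ ∑ l f + ∑ l g
∑-+ []      f g = refl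
∑-+ (a ∷ l) f g = trans (cong (_+_ (f a + g a)) (∑-+ l f g))
                        (interchange (f a) (g a) (∑ l f) (∑ l g))
  where
  interchange : ∀ p q r s → (p + q) + (r + s) ≡ (p + r) + (q + s)
  interchange = solve-∀

∑-*ˡ : ∀ (l : List A) (k : ℤ) (f : A → ℤ) → ∑ l (λ a → k * f a) ≡ k * ∑ l f
∑-*ˡ []      k f = sym (*-zeroʳ k)
∑-*ˡ (a ∷ l) k f = trans (cong (_+_ (k * f a)) (∑-*ˡ l k f)) (sym (*-distribˡ-+ k (f a) _))

∑-onlyIf-*ˡ : ∀ (l : List A) (p : A → Bool) (k : ℤ) (f : A → ℤ) →
              ∑ l (λ a → onlyIf (p a) (k * f a)) ≡ k * ∑ l (λ a → onlyIf (p a) (f a))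
∑-onlyIf-*ˡ l p k f = trans (∑-cong l (λ a → onlyIf-*ˡ (p a) k (f a))) (∑-*ˡ l k (λ a → onlyIf (p a) (f a)))

∑-onlyIf-∧false : ∀ (l : List A) (p : A → Bool) (f : A → ℤ) → ∑ l (λ a → onlyIf (p a ∧ false) (f a)) ≡ 0ℤ
∑-onlyIf-∧false l p f =
  trans (∑-cong l {g = λ _ → 0ℤ} (λ a → cong (λ b → onlyIf b (f a)) (∧-zeroʳ (p a)))) (∑-zero l)

∑-swap : ∀ (l₁ : List A) (l₂ : List B) (f : A → B → ℤ) →
         ∑ l₁ (λ a → ∑ l₂ (f a)) ≡ ∑ l₂ (λ b → ∑ l₁ (λ a → f a b))
∑-swap []       l₂ f = sym (∑-zero l₂)
∑-swap (a ∷ l₁) l₂ f =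
  trans (cong (_+_ (∑ l₂ (f a))) (∑-swap l₁ l₂ f)) (sym (∑-+ l₂ (f a) _))

∑-filter : ∀ (p : A → Bool) (l : List A) (f : A → ℤ) → ∑ (filter (T? ∘ p) l) f ≡ ∑ l (λ a → onlyIf (p a) (f a))
∑-filter p []      f = refl
∑-filter p (a ∷ l) f with p a
... | true  = cong (_+_ (f a)) (∑-filter p l f)
... | false = trans (∑-filter p l f) (sym (+-identityˡ _))

any-false⇒count-zero : ∀ (p : A → Bool) (l : List A) → any p l ≡ false → length (filter (T? ∘ p) l) ≡ 0
any-false⇒count-zero p []      _ = refl
any-false⇒count-zero p (a ∷ l) h with p a
... | false = any-false⇒count-zero p l h

count-tabulate : ∀ {n} (g : Fin n → A) (p : A → Bool) →
                 length (filter (T? ∘ p) (tabulate g)) ≡ ∣ Vec.tabulate (p ∘ g) ∣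
count-tabulate {n = zero}  g p = refl
count-tabulate {n = suc n} g p with p (g zero)
... | true  = cong suc (count-tabulate (g ∘ suc) p)
... | false = count-tabulate (g ∘ suc) p

∑ₛ : (n : ℕ) → (Subset n → ℤ) → ℤ
∑ₛ n f = ∑ (allSubsets n) f

∑ₛ-suc : ∀ n (f : Subset (suc n) → ℤ) →
         ∑ₛ (suc n) f ≡ ∑ₛ n (λ U → f (false ∷ U)) + ∑ₛ n (λ U → f (true ∷ U))
∑ₛ-suc n f = trans (∑-++ (map (false ∷_) (allSubsets n)) _ f)
                   (cong₂ _+_ (∑-map (false ∷_) (allSubsets n) f) (∑-map (true ∷_) (allSubsets n) f))

_⊆ᵇ_ : ∀ {n} → Subset n → Subset n → Bool
[]      ⊆ᵇ []      = true
(a ∷ A) ⊆ᵇ (b ∷ B) = (not a ∨ b) ∧ (A ⊆ᵇ B)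

⊆ᵇ⇔ : ∀ {n} (A B : Subset n) → T (A ⊆ᵇ B) ⇔ (∀ i → T (mem i A) → T (mem i B))
⊆ᵇ⇔ []      []      = mk⇔ (λ _ ()) (λ _ → tt)
⊆ᵇ⇔ (a ∷ A) (b ∷ B) = mk⇔ forward backward
  where
  forward : T ((a ∷ A) ⊆ᵇ (b ∷ B)) → ∀ i → T (mem i (a ∷ A)) → T (mem i (b ∷ B))
  forward h zero    = to T-implies (proj₁ (to T-∧ h))
  forward h (suc i) = to (⊆ᵇ⇔ A B) (proj₂ (to T-∧ h)) i
  backward : (∀ i → T (mem i (a ∷ A)) → T (mem i (b ∷ B))) → T ((a ∷ A) ⊆ᵇ (b ∷ B))
  backward h = from T-∧ (from T-implies (h zero) , from (⊆ᵇ⇔ A B) (h ∘ suc))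

⊆ᵇ-antisym : ∀ {n} (A B : Subset n) → T (A ⊆ᵇ B) → T (B ⊆ᵇ A) → A ≡ B
⊆ᵇ-antisym []          []          _ _ = refl
⊆ᵇ-antisym (true  ∷ A) (true  ∷ B) p q = cong (true ∷_) (⊆ᵇ-antisym A B p q)
⊆ᵇ-antisym (false ∷ A) (false ∷ B) p q = cong (false ∷_) (⊆ᵇ-antisym A B p q)
⊆ᵇ-antisym (true  ∷ A) (false ∷ B) () _
⊆ᵇ-antisym (false ∷ A) (true  ∷ B) _ ()

onlyIf-antisym : ∀ {n} (A B : Subset n) (f : Subset n → ℤ) →
                 onlyIf (A ⊆ᵇ B ∧ B ⊆ᵇ A) (f A) ≡ onlyIf (A ⊆ᵇ B ∧ B ⊆ᵇ A) (f B)
onlyIf-antisym A B f with A ⊆ᵇ B in AB | B ⊆ᵇ A in BA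
... | true  | true  = cong f (⊆ᵇ-antisym A B (from T-≡ AB) (from T-≡ BA))
... | true  | false = refl
... | false | _     = refl

cancel : ∀ t → t + -1ℤ * t ≡ 0ℤ
cancel = solve-∀

alternating-vanishes : ∀ m → ∑ₛ (suc m) (λ U → -1ℤ ^ ∣ U ∣) ≡ 0ℤ
alternating-vanishes m = begin
  ∑ₛ (suc m) (λ U → -1ℤ ^ ∣ U ∣)                    ≡⟨ ∑ₛ-suc m _ ⟩
  t + ∑ₛ m (λ U → -1ℤ * -1ℤ ^ ∣ U ∣)                ≡⟨ cong (_+_ t) (∑-*ˡ (allSubsets m) -1ℤ (λ U → -1ℤ ^ ∣ U ∣)) ⟩
  t + -1ℤ * t                                        ≡⟨ cancel t ⟩
  0ℤ                                                 ∎
  where t = ∑ₛ m (λ U → -1ℤ ^ ∣ U ∣)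

subset-binomial : ∀ n (C : Subset n) (y : ℤ) → ∑ₛ n (λ S → onlyIf (S ⊆ᵇ C) (y ^ ∣ S ∣)) ≡ (1ℤ + y) ^ ∣ C ∣
subset-binomial zero    []          y = refl
subset-binomial (suc n) (false ∷ C) y = trans (∑ₛ-suc n _) $ begin
  ∑ₛ n (λ S → onlyIf (S ⊆ᵇ C) (y ^ ∣ S ∣)) + ∑ₛ n (λ _ → 0ℤ)
    ≡⟨ cong₂ _+_ (subset-binomial n C y) (∑-zero (allSubsets n)) ⟩
  (1ℤ + y) ^ ∣ C ∣ + 0ℤ
    ≡⟨ +-identityʳ _ ⟩
  (1ℤ + y) ^ ∣ C ∣ ∎
subset-binomial (suc n) (true ∷ C) y = trans (∑ₛ-suc n _) $ begin
  t + ∑ₛ n (λ S → onlyIf (S ⊆ᵇ C) (y * y ^ ∣ S ∣))  ≡⟨ cong (_+_ t) (∑-onlyIf-*ˡ (allSubsets n) (_⊆ᵇ C) y (λ S → y ^ ∣ S ∣)) ⟩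
  t + y * t                                          ≡⟨ cong (λ u → u + y * u) (subset-binomial n C y) ⟩
  u + y * u                                          ≡⟨ factor u y ⟩
  (1ℤ + y) * u                                       ∎
  where
  t = ∑ₛ n (λ S → onlyIf (S ⊆ᵇ C) (y ^ ∣ S ∣))
  u = (1ℤ + y) ^ ∣ C ∣
  factor : ∀ u y → u + y * u ≡ (1ℤ + y) * u
  factor = solve-∀

interval-alternating : ∀ n (A B : Subset n) →
  ∑ₛ n (λ U → onlyIf (A ⊆ᵇ U ∧ U ⊆ᵇ B) (-1ℤ ^ ∣ U ∣)) ≡ onlyIf (A ⊆ᵇ B ∧ B ⊆ᵇ A) (-1ℤ ^ ∣ A ∣)
interval-alternating zero [] [] = refl
interval-alternating (suc n) (false ∷ A) (false ∷ B) = trans (∑ₛ-suc n _) $ begin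
  t + ∑ₛ n (λ U → onlyIf (A ⊆ᵇ U ∧ false) (-1ℤ * -1ℤ ^ ∣ U ∣))
    ≡⟨ cong₂ _+_ (interval-alternating n A B) (∑-onlyIf-∧false (allSubsets n) (A ⊆ᵇ_) (λ U → -1ℤ * -1ℤ ^ ∣ U ∣)) ⟩
  onlyIf (A ⊆ᵇ B ∧ B ⊆ᵇ A) (-1ℤ ^ ∣ A ∣) + 0ℤ
    ≡⟨ +-identityʳ _ ⟩
  onlyIf (A ⊆ᵇ B ∧ B ⊆ᵇ A) (-1ℤ ^ ∣ A ∣) ∎
  where t = ∑ₛ n (λ U → onlyIf (A ⊆ᵇ U ∧ U ⊆ᵇ B) (-1ℤ ^ ∣ U ∣))
interval-alternating (suc n) (false ∷ A) (true ∷ B) = trans (∑ₛ-suc n _) $ begin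
  t + ∑ₛ n (λ U → onlyIf (A ⊆ᵇ U ∧ U ⊆ᵇ B) (-1ℤ * -1ℤ ^ ∣ U ∣))
    ≡⟨ cong (_+_ t) (∑-onlyIf-*ˡ (allSubsets n) (λ U → A ⊆ᵇ U ∧ U ⊆ᵇ B) -1ℤ (λ U → -1ℤ ^ ∣ U ∣)) ⟩
  t + -1ℤ * t
    ≡⟨ cancel t ⟩
  0ℤ
    ≡⟨ cong (λ b → onlyIf b (-1ℤ ^ ∣ A ∣)) (∧-zeroʳ (A ⊆ᵇ B)) ⟨
  onlyIf (A ⊆ᵇ B ∧ false) (-1ℤ ^ ∣ A ∣) ∎
  where t = ∑ₛ n (λ U → onlyIf (A ⊆ᵇ U ∧ U ⊆ᵇ B) (-1ℤ ^ ∣ U ∣))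
interval-alternating (suc n) (true ∷ A) (false ∷ B) = trans (∑ₛ-suc n _) $
  cong₂ _+_ (∑-zero (allSubsets n)) (∑-onlyIf-∧false (allSubsets n) (A ⊆ᵇ_) (λ U → -1ℤ * -1ℤ ^ ∣ U ∣))
interval-alternating (suc n) (true ∷ A) (true ∷ B) = trans (∑ₛ-suc n _) $ begin
  ∑ₛ n (λ _ → 0ℤ) + ∑ₛ n (λ U → onlyIf (A ⊆ᵇ U ∧ U ⊆ᵇ B) (-1ℤ * -1ℤ ^ ∣ U ∣))
    ≡⟨ cong₂ _+_ (∑-zero (allSubsets n)) (∑-onlyIf-*ˡ (allSubsets n) (λ U → A ⊆ᵇ U ∧ U ⊆ᵇ B) -1ℤ (λ U → -1ℤ ^ ∣ U ∣)) ⟩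
  0ℤ + -1ℤ * ∑ₛ n (λ U → onlyIf (A ⊆ᵇ U ∧ U ⊆ᵇ B) (-1ℤ ^ ∣ U ∣))
    ≡⟨ +-identityˡ _ ⟩
  -1ℤ * ∑ₛ n (λ U → onlyIf (A ⊆ᵇ U ∧ U ⊆ᵇ B) (-1ℤ ^ ∣ U ∣))
    ≡⟨ cong (-1ℤ *_) (interval-alternating n A B) ⟩
  -1ℤ * onlyIf (A ⊆ᵇ B ∧ B ⊆ᵇ A) (-1ℤ ^ ∣ A ∣)
    ≡⟨ onlyIf-*ˡ (A ⊆ᵇ B ∧ B ⊆ᵇ A) -1ℤ _ ⟨
  onlyIf (A ⊆ᵇ B ∧ B ⊆ᵇ A) (-1ℤ ^ suc ∣ A ∣) ∎

sign-cancel : ∀ j k (x : ℤ) → -1ℤ ^ (j +ℕ k) * ((- x) ^ k * -1ℤ ^ j) ≡ x ^ k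
sign-cancel zero zero x = refl
sign-cancel zero (suc k) x = begin
  -1ℤ * -1ℤ ^ k * ((- x) * (- x) ^ k * 1ℤ)
    ≡⟨ regroup (-1ℤ ^ k) ((- x) ^ k) x ⟩
  x * (-1ℤ ^ k * ((- x) ^ k * 1ℤ))
    ≡⟨ cong (x *_) (sign-cancel zero k x) ⟩
  x * x ^ k ∎
  where
  regroup : ∀ a b x → -1ℤ * a * ((- x) * b * 1ℤ) ≡ x * (a * (b * 1ℤ))
  regroup = solve-∀
sign-cancel (suc j) k x = trans (regroup (-1ℤ ^ (j +ℕ k)) ((- x) ^ k) (-1ℤ ^ j)) (sign-cancel j k x)
  where
  regroup : ∀ a b c → -1ℤ * a * (b * (-1ℤ * c)) ≡ a * (b * c)
  regroup = solve-∀

∈∁⇔ : ∀ {n} (S : Subset n) v → T (mem v (∁ S)) ⇔ (¬ T (mem v S))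
∈∁⇔ S v rewrite lookup-map v not S = T-not

module _ {n : ℕ} (G : Graph n) where

  trapped : Subset n → Subset n
  trapped U = Vec.tabulate (λ v → not (mem v U) ∧ nbhdIn G v U)

  nbhd : Subset n → Subset n
  nbhd S = Vec.tabulate (λ w → any (λ v → mem v S ∧ adj G w v) (allFin n))

  adjacent-sym : ∀ {u v} → T (adj G u v) → T (adj G v u)
  adjacent-sym {u} {v} = subst T (adj-sym G u v)

  ∈trapped⇔ : ∀ U v → T (mem v (trapped U)) ⇔ (¬ T (mem v U) × (∀ w → T (adj G v w) → T (mem w U)))
  ∈trapped⇔ U v rewrite lookup∘tabulate (λ v → not (mem v U) ∧ nbhdIn G v U) v = mk⇔
    (λ h → let (v∉U , N⊆U) = to T-∧ h in to T-not v∉U , λ w → to T-implies (to T-all N⊆U w))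
    (λ (v∉U , N⊆U) → from T-∧ (from T-not v∉U , from T-all (λ w → from T-implies (N⊆U w))))

  ∈nbhd⇔ : ∀ S w → T (mem w (nbhd S)) ⇔ ∃ (λ v → T (mem v S) × T (adj G w v))
  ∈nbhd⇔ S w rewrite lookup∘tabulate (λ w → any (λ v → mem v S ∧ adj G w v) (allFin n)) w = mk⇔
    (λ h → let (v , q) = to T-any h in v , to T-∧ q)
    (λ (v , q) → from T-any (v , from T-∧ q))

  isoCount≡ : ∀ U → isoCount G U ≡ ∣ trapped U ∣
  isoCount≡ U = count-tabulate (λ v → v) (λ v → not (mem v U) ∧ nbhdIn G v U)

  ⊆trapped : ∀ S U → S ⊆ᵇ trapped U ≡ (nbhd S ⊆ᵇ U ∧ U ⊆ᵇ ∁ S)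
  ⊆trapped S U = T-ext forward backward
    where
    forward : T (S ⊆ᵇ trapped U) → T (nbhd S ⊆ᵇ U ∧ U ⊆ᵇ ∁ S)
    forward S⊆C = from T-∧ (from (⊆ᵇ⇔ (nbhd S) U) N⊆U , from (⊆ᵇ⇔ U (∁ S)) U⊆∁S)
      where
      trappedOf : ∀ v → T (mem v S) → ¬ T (mem v U) × (∀ w → T (adj G v w) → T (mem w U))
      trappedOf v v∈S = to (∈trapped⇔ U v) (to (⊆ᵇ⇔ S (trapped U)) S⊆C v v∈S)
      N⊆U : ∀ w → T (mem w (nbhd S)) → T (mem w U)
      N⊆U w w∈N = let (v , v∈S , w~v) = to (∈nbhd⇔ S w) w∈N
                  in proj₂ (trappedOf v v∈S) w (adjacent-sym w~v)
      U⊆∁S : ∀ v → T (mem v U) → T (mem v (∁ S))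
      U⊆∁S v v∈U = from (∈∁⇔ S v) (λ v∈S → proj₁ (trappedOf v v∈S) v∈U)
    backward : T (nbhd S ⊆ᵇ U ∧ U ⊆ᵇ ∁ S) → T (S ⊆ᵇ trapped U)
    backward h = from (⊆ᵇ⇔ S (trapped U)) λ v v∈S → from (∈trapped⇔ U v)
        ( (λ v∈U → to (∈∁⇔ S v) (U⊆∁S v v∈U) v∈S)
        , λ w v~w → N⊆U w (from (∈nbhd⇔ S w) (v , v∈S , adjacent-sym v~w)))
      where
      N⊆U = to (⊆ᵇ⇔ (nbhd S) U) (proj₁ (to T-∧ h))
      U⊆∁S = to (⊆ᵇ⇔ U (∁ S)) (proj₂ (to T-∧ h))

  independent⇔ : ∀ S → isIndependent G S ≡ nbhd S ⊆ᵇ ∁ S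
  independent⇔ S = T-ext forward backward
    where
    forward : T (isIndependent G S) → T (nbhd S ⊆ᵇ ∁ S)
    forward h = from (⊆ᵇ⇔ (nbhd S) (∁ S)) λ w w∈N → from (∈∁⇔ S w) λ w∈S →
      let (v , v∈S , w~v) = to (∈nbhd⇔ S w) w∈N
      in to T-not (to T-all (to T-all h w) v) (from T-∧ (w∈S , from T-∧ (v∈S , w~v)))
    backward : T (nbhd S ⊆ᵇ ∁ S) → T (isIndependent G S)
    backward h = from T-all λ v → from T-all λ w → from T-not λ q →
      let (v∈S , w∈S∧v~w) = to T-∧ q
          (w∈S , v~w)     = to (T-∧ {mem w S}) w∈S∧v~w
      in to (∈∁⇔ S v) (to (⊆ᵇ⇔ (nbhd S) (∁ S)) h v (from (∈nbhd⇔ S v) (w , w∈S , v~w))) v∈S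

  dominating⇔ : ∀ S → isDominating G S ≡ ∁ S ⊆ᵇ nbhd S
  dominating⇔ S = T-ext forward backward
    where
    forward : T (isDominating G S) → T (∁ S ⊆ᵇ nbhd S)
    forward h = from (⊆ᵇ⇔ (∁ S) (nbhd S)) λ v v∉S →
      from (∈nbhd⇔ S v) (neighbourIn v (to (∈∁⇔ S v) v∉S) (to T-all h v))
      where
      neighbourIn : ∀ v → ¬ T (mem v S) → T (mem v S ∨ any (λ w → mem w S ∧ adj G v w) (allFin n)) →
                    ∃ (λ w → T (mem w S) × T (adj G v w))
      neighbourIn v v∉S h with mem v S
      ... | true  = ⊥-elim (v∉S tt)
      ... | false = let (w , q) = to T-any h in w , to T-∧ q
    backward : T (∁ S ⊆ᵇ nbhd S) → T (isDominating G S)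
    backward h = from T-all inOrDominated
      where
      inOrDominated : ∀ v → T (mem v S ∨ any (λ w → mem w S ∧ adj G v w) (allFin n))
      inOrDominated v with mem v S in v∉S-eq
      ... | true  = tt
      ... | false =
        let v∉S = λ v∈S → subst T v∉S-eq v∈S
            (w , w∈S , v~w) = to (∈nbhd⇔ S v) (to (⊆ᵇ⇔ (∁ S) (nbhd S)) h v (from (∈∁⇔ S v) v∉S))
        in from T-any (w , from T-∧ (w∈S , v~w))

  indepDom⇔ : ∀ S → isIndepDom G S ≡ (nbhd S ⊆ᵇ ∁ S ∧ ∁ S ⊆ᵇ nbhd S)
  indepDom⇔ S = cong₂ _∧_ (independent⇔ S) (dominating⇔ S)

essentialTerm : ∀ {n} → Graph n → ℤ → Subset n → ℤ
essentialTerm G x U = -1ℤ ^ ∣ U ∣ * ((1ℤ - x) ^ isoCount G U - 1ℤ)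

-- A non-essential U has C(U) = ∅, so its summand is 0 and the restriction
-- of the sum to essential sets can be dropped.
essentialSum-unrestricted : ∀ {n} (G : Graph n) x → essentialSum G x ≡ -1ℤ ^ n * ∑ₛ n (essentialTerm G x)
essentialSum-unrestricted {n} G x =
  cong (-1ℤ ^ n *_) (trans (∑-filter (isEssential G) (allSubsets n) (essentialTerm G x))
                           (∑-cong (allSubsets n) nonEssential-vanishes))
  where
  nonEssential-vanishes : ∀ U → onlyIf (isEssential G U) (essentialTerm G x U) ≡ essentialTerm G x U
  nonEssential-vanishes U with isEssential G U in ess
  ... | true  = refl
  ... | false rewrite any-false⇒count-zero (λ v → not (mem v U) ∧ nbhdIn G v U) (allFin n) ess =
    sym (*-zeroʳ (-1ℤ ^ ∣ U ∣))

essentialTerm-expand : ∀ {n} (G : Graph n) x U →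
  essentialTerm G x U ≡ ∑ₛ n (λ S → onlyIf (S ⊆ᵇ trapped G U) (-1ℤ ^ ∣ U ∣ * (- x) ^ ∣ S ∣)) + -1ℤ * -1ℤ ^ ∣ U ∣
essentialTerm-expand {n} G x U = begin
  sign * ((1ℤ - x) ^ isoCount G U - 1ℤ)
    ≡⟨ cong (λ k → sign * ((1ℤ - x) ^ k - 1ℤ)) (isoCount≡ G U) ⟩
  sign * ((1ℤ + - x) ^ ∣ trapped G U ∣ - 1ℤ)
    ≡⟨ cong (λ t → sign * (t - 1ℤ)) (subset-binomial n (trapped G U) (- x)) ⟨
  sign * (t - 1ℤ)
    ≡⟨ distribute sign t ⟩
  sign * t + -1ℤ * sign
    ≡⟨ cong (_+ -1ℤ * sign) (∑-onlyIf-*ˡ (allSubsets n) (_⊆ᵇ trapped G U) sign (λ S → (- x) ^ ∣ S ∣)) ⟨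
  ∑ₛ n (λ S → onlyIf (S ⊆ᵇ trapped G U) (sign * (- x) ^ ∣ S ∣)) + -1ℤ * sign ∎
  where
  sign = -1ℤ ^ ∣ U ∣
  t = ∑ₛ n (λ S → onlyIf (S ⊆ᵇ trapped G U) ((- x) ^ ∣ S ∣))
  distribute : ∀ a t → a * (t - 1ℤ) ≡ a * t + -1ℤ * a
  distribute = solve-∀

exchanged-inner : ∀ {n} (G : Graph n) (y : ℤ) S →
  ∑ₛ n (λ U → onlyIf (S ⊆ᵇ trapped G U) (-1ℤ ^ ∣ U ∣ * y ^ ∣ S ∣)) ≡ y ^ ∣ S ∣ * onlyIf (isIndepDom G S) (-1ℤ ^ ∣ ∁ S ∣)
exchanged-inner {n} G y S = begin
  ∑ₛ n (λ U → onlyIf (S ⊆ᵇ trapped G U) (-1ℤ ^ ∣ U ∣ * y ^ ∣ S ∣))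
    ≡⟨ ∑-cong (allSubsets n) (λ U → cong₂ onlyIf (⊆trapped G S U) (*-comm (-1ℤ ^ ∣ U ∣) (y ^ ∣ S ∣))) ⟩
  ∑ₛ n (λ U → onlyIf (N ⊆ᵇ U ∧ U ⊆ᵇ ∁ S) (y ^ ∣ S ∣ * -1ℤ ^ ∣ U ∣))
    ≡⟨ ∑-onlyIf-*ˡ (allSubsets n) (λ U → N ⊆ᵇ U ∧ U ⊆ᵇ ∁ S) (y ^ ∣ S ∣) (λ U → -1ℤ ^ ∣ U ∣) ⟩
  y ^ ∣ S ∣ * ∑ₛ n (λ U → onlyIf (N ⊆ᵇ U ∧ U ⊆ᵇ ∁ S) (-1ℤ ^ ∣ U ∣))
    ≡⟨ cong (y ^ ∣ S ∣ *_) (interval-alternating n N (∁ S)) ⟩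
  y ^ ∣ S ∣ * onlyIf (N ⊆ᵇ ∁ S ∧ ∁ S ⊆ᵇ N) (-1ℤ ^ ∣ N ∣)
    ≡⟨ cong (y ^ ∣ S ∣ *_) (onlyIf-antisym N (∁ S) (λ A → -1ℤ ^ ∣ A ∣)) ⟩
  y ^ ∣ S ∣ * onlyIf (N ⊆ᵇ ∁ S ∧ ∁ S ⊆ᵇ N) (-1ℤ ^ ∣ ∁ S ∣)
    ≡⟨ cong (λ b → y ^ ∣ S ∣ * onlyIf b (-1ℤ ^ ∣ ∁ S ∣)) (indepDom⇔ G S) ⟨
  y ^ ∣ S ∣ * onlyIf (isIndepDom G S) (-1ℤ ^ ∣ ∁ S ∣) ∎
  where N = nbhd G S

essentialTerms-sum : ∀ m (G : Graph (suc m)) x →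
  ∑ₛ (suc m) (essentialTerm G x) ≡ ∑ₛ (suc m) (λ S → (- x) ^ ∣ S ∣ * onlyIf (isIndepDom G S) (-1ℤ ^ ∣ ∁ S ∣))
essentialTerms-sum m G x = begin
  ∑ₛ n (essentialTerm G x)
    ≡⟨ ∑-cong (allSubsets n) (essentialTerm-expand G x) ⟩
  ∑ₛ n (λ U → inner U + -1ℤ * -1ℤ ^ ∣ U ∣)
    ≡⟨ ∑-+ (allSubsets n) inner (λ U → -1ℤ * -1ℤ ^ ∣ U ∣) ⟩
  ∑ₛ n inner + ∑ₛ n (λ U → -1ℤ * -1ℤ ^ ∣ U ∣)
    ≡⟨ cong (_+_ (∑ₛ n inner)) (trans (∑-*ˡ (allSubsets n) -1ℤ (λ U → -1ℤ ^ ∣ U ∣))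
                                    (cong (-1ℤ *_) (alternating-vanishes m))) ⟩
  ∑ₛ n inner + 0ℤ
    ≡⟨ +-identityʳ _ ⟩
  ∑ₛ n inner
    ≡⟨ ∑-swap (allSubsets n) (allSubsets n) (λ U S → onlyIf (S ⊆ᵇ trapped G U) (-1ℤ ^ ∣ U ∣ * (- x) ^ ∣ S ∣)) ⟩
  ∑ₛ n (λ S → ∑ₛ n (λ U → onlyIf (S ⊆ᵇ trapped G U) (-1ℤ ^ ∣ U ∣ * (- x) ^ ∣ S ∣)))
    ≡⟨ ∑-cong (allSubsets n) (exchanged-inner G (- x)) ⟩
  ∑ₛ n (λ S → (- x) ^ ∣ S ∣ * onlyIf (isIndepDom G S) (-1ℤ ^ ∣ ∁ S ∣)) ∎
  where
  n = suc m
  inner = λ U → ∑ₛ n (λ S → onlyIf (S ⊆ᵇ trapped G U) (-1ℤ ^ ∣ U ∣ * (- x) ^ ∣ S ∣))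

complement-size : ∀ {n} (S : Subset n) → ∣ ∁ S ∣ +ℕ ∣ S ∣ ≡ n
complement-size S = trans (cong (_+ℕ ∣ S ∣) (∣∁p∣≡n∸∣p∣ S)) (m∸n+n≡m (∣p∣≤n S))

signs-collapse : ∀ {n} (S : Subset n) x b →
  -1ℤ ^ n * ((- x) ^ ∣ S ∣ * onlyIf b (-1ℤ ^ ∣ ∁ S ∣)) ≡ onlyIf b (x ^ ∣ S ∣)
signs-collapse {n} S x false = trans (cong (-1ℤ ^ n *_) (*-zeroʳ ((- x) ^ ∣ S ∣))) (*-zeroʳ (-1ℤ ^ n))
signs-collapse {n} S x true = begin
  -1ℤ ^ n * ((- x) ^ ∣ S ∣ * -1ℤ ^ ∣ ∁ S ∣)
    ≡⟨ cong (λ k → -1ℤ ^ k * ((- x) ^ ∣ S ∣ * -1ℤ ^ ∣ ∁ S ∣)) (complement-size S) ⟨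
  -1ℤ ^ (∣ ∁ S ∣ +ℕ ∣ S ∣) * ((- x) ^ ∣ S ∣ * -1ℤ ^ ∣ ∁ S ∣)
    ≡⟨ sign-cancel ∣ ∁ S ∣ ∣ S ∣ x ⟩
  x ^ ∣ S ∣ ∎

mainTheorem11 : (n : ℕ) → 1 ≤ n → (G : Graph n) → (x : ℤ) →
    ID G x ≡ essentialSum G x
mainTheorem11 (suc m) _ G x = begin
  ID G x
    ≡⟨ ∑-filter (isIndepDom G) (allSubsets n) (λ W → x ^ ∣ W ∣) ⟩
  ∑ₛ n (λ S → onlyIf (isIndepDom G S) (x ^ ∣ S ∣))
    ≡⟨ ∑-cong (allSubsets n) (λ S → signs-collapse S x (isIndepDom G S)) ⟨
  ∑ₛ n (λ S → -1ℤ ^ n * surviving S)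
    ≡⟨ ∑-*ˡ (allSubsets n) (-1ℤ ^ n) surviving ⟩
  -1ℤ ^ n * ∑ₛ n surviving
    ≡⟨ cong (-1ℤ ^ n *_) (essentialTerms-sum m G x) ⟨
  -1ℤ ^ n * ∑ₛ n (essentialTerm G x)
    ≡⟨ essentialSum-unrestricted G x ⟨
  essentialSum G x ∎
  where
  n = suc m
  surviving = λ S → (- x) ^ ∣ S ∣ * onlyIf (isIndepDom G S) (-1ℤ ^ ∣ ∁ S ∣)
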